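{- Let $k\ge 1$ and let $H(k)$ be the half graph with color classes $\{u_1,\ldots,u_k\}$ and $\{v_1,\ldots,v_k\}$, where $u_i\sim v_j$ if and only if $j\le k-i+1$. Let $(a_1,\ldots,a_6)=(1,0,-1,-1,0,1)$ and define $\mathbf{x}=(x_1,\ldots,x_k)$ by $x_i=a_s$ whenever $i\equiv s \pmod 6$, $1\le s\le 6$. Let $\mathbf{y}$ be the vector on $V(H(k))$ with $\mathbf{y}(u_i)=\mathbf{y}(v_i)=x_i$ for $i=1,\ldots,k$. Then $\mathbf{y}$ is an eigenvector of the adjacency matrix of $H(k)$ for eigenvalue $1$ if $k\equiv 1\pmod 6$, and it is an eigenvector for eigenvalue $-1$ if $k\equiv 4\pmod 6$.
   Context: Graphs are simple and undirected; the adjacency matrix $A(G)$ has $(i,j)$-entry $1$ if the $i$-th and $j$-th vertices are adjacent and $0$ otherwise. The half graph $H(k)$ is as defined in the claim. -}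

module Defs where

open import Data.Nat as ℕ using (ℕ; zero; suc; _%_)
open import Data.Nat.Properties as ℕP using ()
open import Data.Fin as Fin using (Fin; toℕ)
open import Data.Sum using (_⊎_; inj₁; inj₂)
open import Data.Integer as ℤ using (ℤ; +_; -_; 0ℤ; 1ℤ)
open import Data.Bool using (Bool; true; false; if_then_else_)
open import Relation.Nullary.Decidable using (⌊_⌋)
open import Relation.Binary.PropositionalEquality using (_≡_)
open import Data.Product using (_×_; Σ)
open import Relation.Nullary using (¬_)

-- Vertex set of the half graph H(k): inj₁ i is u_{i+1}, inj₂ j is v_{j+1}
-- (0-based indices i, j : Fin k).
HVertex : ℕ → Set
HVertex k = Fin k ⊎ Fin k

-- u_{i+1} ~ v_{j+1}  iff  j+1 ≤ k-(i+1)+1  iff  i + j + 1 ≤ k  iff  i + j < k.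
-- No edges inside a colour class.
halfAdj : (k : ℕ) → HVertex k → HVertex k → Bool
halfAdj k (inj₁ i) (inj₂ j) = ⌊ suc (toℕ i) ℕ.≤? ℕ._∸_ k (toℕ j) ⌋
halfAdj k (inj₂ j) (inj₁ i) = ⌊ suc (toℕ i) ℕ.≤? ℕ._∸_ k (toℕ j) ⌋
halfAdj k (inj₁ _) (inj₁ _) = false
halfAdj k (inj₂ _) (inj₂ _) = false

adjMatrix : (k : ℕ) → HVertex k → HVertex k → ℤ
adjMatrix k a b = if halfAdj k a b then 1ℤ else 0ℤ

sumFin : (n : ℕ) → (Fin n → ℤ) → ℤ
sumFin zero f = 0ℤ
sumFin (suc n) f = f Fin.zero ℤ.+ sumFin n (λ i → f (Fin.suc i))

sumV : (k : ℕ) → (HVertex k → ℤ) → ℤ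
sumV k f = sumFin k (λ i → f (inj₁ i)) ℤ.+ sumFin k (λ j → f (inj₂ j))

mulVec : (k : ℕ) → (HVertex k → HVertex k → ℤ) → (HVertex k → ℤ) → HVertex k → ℤ
mulVec k M y a = sumV k (λ b → M a b ℤ.* y b)

IsEigenvector : (k : ℕ) → (HVertex k → HVertex k → ℤ) → ℤ → (HVertex k → ℤ) → Set
IsEigenvector k M λ' y =
  Σ (HVertex k) (λ a → ¬ (y a ≡ 0ℤ)) × ((a : HVertex k) → mulVec k M y a ≡ λ' ℤ.* y a)

-- (a_1,…,a_6) = (1,0,-1,-1,0,1), indexed by s-1 ∈ {0,…,5}.
aSeq : ℕ → ℤ
aSeq 0 = 1ℤ
aSeq 1 = 0ℤ
aSeq 2 = - 1ℤ
aSeq 3 = - 1ℤ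
aSeq 4 = 0ℤ
aSeq _ = 1ℤ

-- x_i = a_s when i ≡ s (mod 6), 1 ≤ s ≤ 6; for 1-based i this is aSeq ((i-1) mod 6).
-- Here i0 = i - 1 is the 0-based index.
xVec : (k : ℕ) → Fin k → ℤ
xVec k i0 = aSeq (toℕ i0 % 6)

yVec : (k : ℕ) → HVertex k → ℤ
yVec k (inj₁ i) = xVec k i
yVec k (inj₂ i) = xVec k i

-- The sequence x satisfies x(j+5) = x(j+4) + x(j), so its prefix sums are again
-- shifts of it: x_1 + ⋯ + x_m = x_{m+5}.  Since u_i ~ v_j iff i + j ≤ k + 1, both
-- u_i and v_i see exactly the first k - i + 1 vertices of the other class, so
-- (A y)(u_i) = (A y)(v_i) = x_{k-i+6}.
-- Finally x is palindromic with period 6 (x_j = x_l when j + l ≡ 1) and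
-- antiperiodic with antiperiod 3, which turns x_{k-i+6} into x_i when k ≡ 1 and
-- into -x_i when k ≡ 4.
module Submission where

open import Defs
open import Data.Bool using (if_then_else_)
import Data.Fin as Fin
open Fin using (Fin; toℕ)
open import Data.Fin.Properties using (toℕ<n)
open import Data.Integer using (ℤ; 0ℤ; 1ℤ; -_; _+_; _*_)
open import Data.Integer.Properties
  using (+-identityˡ; +-identityʳ; +-assoc; *-identityˡ; -1*i≡-i; neg-involutive)
open import Data.Nat using (ℕ; zero; suc; _∸_; _%_; _/_; _≤_; _<_; _≥_; _≤?_; z≤n; s≤s; s<s⁻¹)
  renaming (_+_ to _+ℕ_; _*_ to _*ℕ_)
open import Data.Nat.DivMod using ([m+n]%n≡m%n; [m+kn]%n≡m%n; m≡m%n+[m/n]*n)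
import Data.Nat.Properties as ℕ
open import Data.Product using (_×_; _,_)
open import Data.Sum using (inj₁; inj₂)
open import Relation.Nullary using (Dec; yes; no; ¬_; contradiction)
open import Relation.Nullary.Decidable using (⌊_⌋)
open import Relation.Binary.PropositionalEquality
  using (_≡_; refl; sym; trans; cong; cong₂; module ≡-Reasoning)

open ≡-Reasoning

-- x j is the paper's x_{j+1}; by definition xVec k i ≡ x (toℕ i).
x : ℕ → ℤ
x j = aSeq (j % 6)

x-periodic : ∀ j → x (6 +ℕ j) ≡ x j
x-periodic j = cong aSeq (trans (cong (_% 6) (ℕ.+-comm 6 j)) ([m+n]%n≡m%n j 6))

x-periodic-* : ∀ j q → x (j +ℕ q *ℕ 6) ≡ x j
x-periodic-* j q = cong aSeq ([m+kn]%n≡m%n j q 6)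

x-antiperiodic : ∀ j → x (3 +ℕ j) ≡ - x j
x-antiperiodic 0 = refl
x-antiperiodic 1 = refl
x-antiperiodic 2 = refl
x-antiperiodic (suc (suc (suc j))) = begin
  x (6 +ℕ j)       ≡⟨ x-periodic j ⟩
  x j              ≡⟨ neg-involutive (x j) ⟨
  - - x j          ≡⟨ cong -_ (x-antiperiodic j) ⟨
  - x (3 +ℕ j)     ∎

x-recurrence : ∀ j → x (5 +ℕ j) ≡ x (4 +ℕ j) + x j
x-recurrence 0 = refl
x-recurrence 1 = refl
x-recurrence 2 = refl
x-recurrence 3 = refl
x-recurrence 4 = refl
x-recurrence 5 = refl
x-recurrence (suc (suc (suc (suc (suc (suc j)))))) = begin
  x (6 +ℕ (5 +ℕ j))                  ≡⟨ x-periodic (5 +ℕ j) ⟩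
  x (5 +ℕ j)                         ≡⟨ x-recurrence j ⟩
  x (4 +ℕ j) + x j                   ≡⟨ cong₂ _+_ (x-periodic (4 +ℕ j)) (x-periodic j) ⟨
  x (6 +ℕ (4 +ℕ j)) + x (6 +ℕ j)     ∎

x-symmetric : ∀ q j l → j +ℕ l ≡ 5 +ℕ q *ℕ 6 → x j ≡ x l
x-symmetric q 0 l refl = sym (x-periodic-* 5 q)
x-symmetric q 1 l refl = sym (x-periodic-* 4 q)
x-symmetric q 2 l refl = sym (x-periodic-* 3 q)
x-symmetric q 3 l refl = sym (x-periodic-* 2 q)
x-symmetric q 4 l refl = sym (x-periodic-* 1 q)
x-symmetric q 5 l refl = sym (x-periodic-* 0 q)
x-symmetric zero (suc (suc (suc (suc (suc (suc j)))))) l ()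
x-symmetric (suc q) (suc (suc (suc (suc (suc (suc j)))))) l j+l≡ =
  trans (x-periodic j) (x-symmetric q j l (cong (_∸ 6) j+l≡))

x-antisymmetric : ∀ q j l → j +ℕ l ≡ 2 +ℕ q *ℕ 6 → x j ≡ - x l
x-antisymmetric q j l j+l≡ =
  trans (x-symmetric q j (3 +ℕ l) j+[3+l]≡) (x-antiperiodic l)
  where
  j+[3+l]≡ : j +ℕ (3 +ℕ l) ≡ 5 +ℕ q *ℕ 6
  j+[3+l]≡ = trans (ℕ.+-comm j (3 +ℕ l)) (cong (3 +ℕ_) (trans (ℕ.+-comm l j) j+l≡))

sumFin-zero : ∀ n → sumFin n (λ _ → 0ℤ) ≡ 0ℤ
sumFin-zero zero = refl
sumFin-zero (suc n) = trans (+-identityˡ _) (sumFin-zero n)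

sumFin-cong : ∀ n {f g : Fin n → ℤ} → (∀ j → f j ≡ g j) → sumFin n f ≡ sumFin n g
sumFin-cong zero f≗g = refl
sumFin-cong (suc n) f≗g = cong₂ _+_ (f≗g Fin.zero) (sumFin-cong n (λ j → f≗g (Fin.suc j)))

sumFin-snoc : ∀ n (f : ℕ → ℤ) → sumFin (suc n) (λ j → f (toℕ j)) ≡ sumFin n (λ j → f (toℕ j)) + f n
sumFin-snoc zero f = trans (+-identityʳ (f 0)) (sym (+-identityˡ (f 0)))
sumFin-snoc (suc n) f = trans (cong (f 0 +_) (sumFin-snoc n (λ j → f (suc j))))
                              (sym (+-assoc (f 0) _ (f (suc n))))

indicator-yes : ∀ {A : Set} (a? : Dec A) z → A → (if ⌊ a? ⌋ then 1ℤ else 0ℤ) * z ≡ z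
indicator-yes (yes _) z _ = *-identityˡ z
indicator-yes (no ¬a) z a = contradiction a ¬a

indicator-no : ∀ {A : Set} (a? : Dec A) z → ¬ A → (if ⌊ a? ⌋ then 1ℤ else 0ℤ) * z ≡ 0ℤ
indicator-no (yes a) z ¬a = contradiction a ¬a
indicator-no (no _) z _ = refl

sumFin-indicator : ∀ n m {P : ℕ → Set} (P? : ∀ j → Dec (P j)) (f : ℕ → ℤ) → m ≤ n →
  (∀ j → P j → j < m) → (∀ j → j < m → P j) →
  sumFin n (λ j → (if ⌊ P? (toℕ j) ⌋ then 1ℤ else 0ℤ) * f (toℕ j)) ≡ sumFin m (λ j → f (toℕ j))
sumFin-indicator n zero P? f _ P⇒<0 _ =
  trans (sumFin-cong n (λ j → indicator-no (P? (toℕ j)) (f (toℕ j)) (λ p → ℕ.n≮0 (P⇒<0 (toℕ j) p))))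
        (sumFin-zero n)
sumFin-indicator (suc n) (suc m) P? f (s≤s m≤n) P⇒< <⇒P =
  cong₂ _+_ (indicator-yes (P? 0) (f 0) (<⇒P 0 (s≤s z≤n)))
            (sumFin-indicator n m (λ j → P? (suc j)) (λ j → f (suc j)) m≤n
              (λ j p → s<s⁻¹ (P⇒< (suc j) p)) (λ j j<m → <⇒P (suc j) (s≤s j<m)))

x-prefix-sum : ∀ n → sumFin n (λ j → x (toℕ j)) ≡ x (4 +ℕ n)
x-prefix-sum zero = refl
x-prefix-sum (suc n) = begin
  sumFin (suc n) (λ j → x (toℕ j))    ≡⟨ sumFin-snoc n x ⟩
  sumFin n (λ j → x (toℕ j)) + x n    ≡⟨ cong (_+ x n) (x-prefix-sum n) ⟩
  x (4 +ℕ n) + x n                    ≡⟨ x-recurrence n ⟨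
  x (5 +ℕ n)                          ∎

<-∸-comm : ∀ {k i j} → i < k ∸ j → j < k ∸ i
<-∸-comm {k} {i} {j} i<k∸j =
  ℕ.m+n≤o⇒m≤o∸n (suc j) (ℕ.≤-trans (ℕ.≤-reflexive (cong suc (ℕ.+-comm j i)))
                                    (ℕ.m≤o∸n⇒m+n≤o (suc i) (ℕ.<⇒≤ j<k) i<k∸j))
  where
  j<k : j < k
  j<k = ℕ.m∸n≢0⇒n<m (ℕ.m<n⇒n≢0 i<k∸j)

A-y-u : ∀ k (i : Fin k) → mulVec k (adjMatrix k) (yVec k) (inj₁ i) ≡ x (4 +ℕ (k ∸ toℕ i))
A-y-u k i = begin
  mulVec k (adjMatrix k) (yVec k) (inj₁ i)   ≡⟨ cong₂ _+_ (sumFin-zero k) neighbours ⟩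
  0ℤ + sumFin (k ∸ toℕ i) (λ j → x (toℕ j))  ≡⟨ +-identityˡ _ ⟩
  sumFin (k ∸ toℕ i) (λ j → x (toℕ j))       ≡⟨ x-prefix-sum (k ∸ toℕ i) ⟩
  x (4 +ℕ (k ∸ toℕ i))                       ∎
  where
  neighbours : sumFin k (λ j → adjMatrix k (inj₁ i) (inj₂ j) * yVec k (inj₂ j))
             ≡ sumFin (k ∸ toℕ i) (λ j → x (toℕ j))
  neighbours = sumFin-indicator k (k ∸ toℕ i) (λ j → suc (toℕ i) ≤? k ∸ j) x (ℕ.m∸n≤m k (toℕ i))
                 (λ _ → <-∸-comm) (λ _ → <-∸-comm)

A-y-v : ∀ k (i : Fin k) → mulVec k (adjMatrix k) (yVec k) (inj₂ i) ≡ x (4 +ℕ (k ∸ toℕ i))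
A-y-v k i = begin
  mulVec k (adjMatrix k) (yVec k) (inj₂ i)   ≡⟨ cong₂ _+_ neighbours (sumFin-zero k) ⟩
  sumFin (k ∸ toℕ i) (λ j → x (toℕ j)) + 0ℤ  ≡⟨ +-identityʳ _ ⟩
  sumFin (k ∸ toℕ i) (λ j → x (toℕ j))       ≡⟨ x-prefix-sum (k ∸ toℕ i) ⟩
  x (4 +ℕ (k ∸ toℕ i))                       ∎
  where
  neighbours : sumFin k (λ j → adjMatrix k (inj₂ i) (inj₁ j) * yVec k (inj₁ j))
             ≡ sumFin (k ∸ toℕ i) (λ j → x (toℕ j))
  neighbours = sumFin-indicator k (k ∸ toℕ i) (λ j → suc j ≤? k ∸ toℕ i) x (ℕ.m∸n≤m k (toℕ i))
                 (λ _ j<k∸i → j<k∸i) (λ _ j<k∸i → j<k∸i)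

y-eigenvector : ∀ k λ' → (∀ i → i < suc k → x (4 +ℕ (suc k ∸ i)) ≡ λ' * x i) →
  IsEigenvector (suc k) (adjMatrix (suc k)) λ' (yVec (suc k))
y-eigenvector k λ' A-y≡λ'y = (inj₁ Fin.zero , λ ()) , λ
  { (inj₁ i) → trans (A-y-u (suc k) i) (A-y≡λ'y (toℕ i) (toℕ<n i))
  ; (inj₂ i) → trans (A-y-v (suc k) i) (A-y≡λ'y (toℕ i) (toℕ<n i)) }

4+k∸i+i : ∀ {k i} r → i ≤ k → k % 6 ≡ r → 4 +ℕ (k ∸ i) +ℕ i ≡ 4 +ℕ r +ℕ (k / 6) *ℕ 6
4+k∸i+i {k} {i} r i≤k k%6≡r = begin
  4 +ℕ (k ∸ i) +ℕ i             ≡⟨ ℕ.+-assoc 4 (k ∸ i) i ⟩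
  4 +ℕ ((k ∸ i) +ℕ i)           ≡⟨ cong (4 +ℕ_) (ℕ.m∸n+n≡m i≤k) ⟩
  4 +ℕ k                        ≡⟨ cong (4 +ℕ_) (m≡m%n+[m/n]*n k 6) ⟩
  4 +ℕ (k % 6 +ℕ (k / 6) *ℕ 6)  ≡⟨ cong (λ r → 4 +ℕ (r +ℕ (k / 6) *ℕ 6)) k%6≡r ⟩
  4 +ℕ (r +ℕ (k / 6) *ℕ 6)      ≡⟨ ℕ.+-assoc 4 r _ ⟨
  4 +ℕ r +ℕ (k / 6) *ℕ 6        ∎

theorem3p4 : (k : ℕ) → k ≥ 1 →
    ((k % 6 ≡ 1 → IsEigenvector k (adjMatrix k) 1ℤ (yVec k))
     × (k % 6 ≡ 4 → IsEigenvector k (adjMatrix k) (- 1ℤ) (yVec k)))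
theorem3p4 (suc k) _ =
    (λ k%6≡1 → y-eigenvector k 1ℤ λ i i<k →
       trans (x-symmetric (suc k / 6) _ i (4+k∸i+i 1 (ℕ.<⇒≤ i<k) k%6≡1)) (sym (*-identityˡ (x i))))
  -- 4 + 4 + 6q is 2 + 6(q + 1) by computation.
  , (λ k%6≡4 → y-eigenvector k (- 1ℤ) λ i i<k →
       trans (x-antisymmetric (suc (suc k / 6)) _ i (4+k∸i+i 4 (ℕ.<⇒≤ i<k) k%6≡4)) (sym (-1*i≡-i (x i))))
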